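{- Let $n\ge1$ and let $K$ be a pure $n$-simplicial complex. Then $K$ is connected if and only if $K$ has an $(n-1)$-ordering.
   Context: A simplicial complex on a finite vertex set is a collection of non-empty vertex subsets containing all singletons and closed under non-empty subsets; a $k$-simplex has $k+1$ vertices; $\tau$ is a face of $\sigma$ if $\tau\subseteq\sigma$. $K$ is a pure $n$-simplicial complex if $\dim K=n$ and every simplex is a face of some $n$-simplex. For a set $S$ of simplices, $\overline{S}$ is the set of all faces of members of $S$. An $(n-1,n)$-walk sequence is an alternating sequence $\sigma_1,\eta_1,\sigma_2,\dots,\sigma_r,\eta_r,\sigma_{r+1}$ of $(n-1)$-simplices $\sigma_k$ and $n$-simplices $\eta_k$ with $\sigma_k\ne\sigma_{k+1}$ both faces of $\eta_k$; it is an $(n-1,n)$-path sequence if all its simplices are distinct. $K$ is connected if there is an $(n-1,n)$-path sequence between every pair of distinct $(n-1)$-simplices. For an $n$-simplex $\eta$ of a pure $n$-simplicial complex $L$, the attachment $\mathcal{A}(\eta,L)$ is the subcomplex of all faces of $\eta$ that are also faces of some $n$-simplex of $L$ other than $\eta$. $K$ has an $(n-1)$-ordering if its $n$-simplices can be listed, each exactly once, as $\eta_1,\dots,\eta_t$ ($t$ the number of $n$-simplices) such that for each $2\le i\le t$, with $K_i=\overline{\{\eta_1,\dots,\eta_i\}}$, the attachment $\mathcal{A}(\eta_i,K_i)$ is an $(n-1)$-dimensional simplicial complex. -}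

module Defs where

open import Data.Nat using (ℕ; zero; suc; _≤_; _<_)
open import Data.Fin using (Fin)
open import Data.Fin.Subset using (Subset; _⊆_; ∣_∣; ⁅_⁆; Nonempty)
open import Data.List using (List; length; lookup; take)
open import Data.List.Membership.Propositional using (_∈_)
open import Data.List.Relation.Unary.Unique.Propositional using (Unique)
open import Data.Vec as Vec using (Vec)
import Data.Fin as F
open import Data.Product using (Σ; ∃; ∃-syntax; _×_)
open import Relation.Binary.PropositionalEquality using (_≡_; _≢_)
open import Function using (Injective)
open import Function.Bundles using (_⇔_)

-- Vertex set: Fin m.  A simplex is a (non-empty) subset of Fin m.
-- A finite collection of simplices is given as a list (membership = ∈).

record IsSimplicialComplex {m : ℕ} (K : List (Subset m)) : Set where
  field
    nonempty  : ∀ σ → σ ∈ K → Nonempty σ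
    singleton : ∀ (v : Fin m) → ⁅ v ⁆ ∈ K
    closed    : ∀ σ τ → σ ∈ K → τ ⊆ σ → Nonempty τ → τ ∈ K

HasDim : ∀ {m} → List (Subset m) → ℕ → Set
HasDim K n = (∃[ σ ] (σ ∈ K × ∣ σ ∣ ≡ suc n)) × (∀ σ → σ ∈ K → ∣ σ ∣ ≤ suc n)

record IsPure {m : ℕ} (n : ℕ) (K : List (Subset m)) : Set where
  field
    complex : IsSimplicialComplex K
    dim     : HasDim K n
    pure    : ∀ σ → σ ∈ K → ∃[ η ] (η ∈ K × ∣ η ∣ ≡ suc n × σ ⊆ η)

-- (n-1,n)-path sequence  σ₁ η₁ σ₂ … σ_r η_r σ_{r+1}  in K, from σ to τ.
-- (n-1)-simplices have n vertices, n-simplices have n+1 vertices.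
record PathSeq {m : ℕ} (n : ℕ) (K : List (Subset m)) (σ τ : Subset m) : Set where
  field
    r     : ℕ
    sigs  : Vec (Subset m) (suc r)
    etas  : Vec (Subset m) r
    sig-in  : ∀ (k : Fin (suc r)) → Vec.lookup sigs k ∈ K × ∣ Vec.lookup sigs k ∣ ≡ n
    eta-in  : ∀ (k : Fin r) → Vec.lookup etas k ∈ K × ∣ Vec.lookup etas k ∣ ≡ suc n
    step-≢  : ∀ (k : Fin r) → Vec.lookup sigs (F.inject₁ k) ≢ Vec.lookup sigs (F.suc k)
    step-l  : ∀ (k : Fin r) → Vec.lookup sigs (F.inject₁ k) ⊆ Vec.lookup etas k
    step-r  : ∀ (k : Fin r) → Vec.lookup sigs (F.suc k) ⊆ Vec.lookup etas k
    sigs-distinct : Injective _≡_ _≡_ (Vec.lookup sigs)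
    etas-distinct : Injective _≡_ _≡_ (Vec.lookup etas)
    cross-distinct : ∀ (i : Fin (suc r)) (j : Fin r) → Vec.lookup sigs i ≢ Vec.lookup etas j
    start : Vec.lookup sigs F.zero ≡ σ
    end   : Vec.lookup sigs (F.fromℕ r) ≡ τ

Connected : ∀ {m} → ℕ → List (Subset m) → Set
Connected {m} n K = ∀ (σ τ : Subset m) → σ ∈ K → ∣ σ ∣ ≡ n → τ ∈ K → ∣ τ ∣ ≡ n →
  σ ≢ τ → PathSeq n K σ τ

InClosure : ∀ {m} → List (Subset m) → Subset m → Set
InClosure S τ = Nonempty τ × ∃[ η ] (η ∈ S × τ ⊆ η)

-- τ ∈ 𝒜(η, L) where L is given as the closure of the list S:
-- τ is a face of η that is also a face of some n-simplex of L other than η.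
InAttachment : ∀ {m} → ℕ → List (Subset m) → Subset m → Subset m → Set
InAttachment n S η τ = Nonempty τ × τ ⊆ η ×
  ∃[ η' ] (InClosure S η' × ∣ η' ∣ ≡ suc n × η' ≢ η × τ ⊆ η')

record Ordering {m : ℕ} (n : ℕ) (K : List (Subset m)) : Set where
  field
    order   : List (Subset m)
    unique  : Unique order
    lists-n : ∀ η → (η ∈ order ⇔ (η ∈ K × ∣ η ∣ ≡ suc n))
    -- for 2 ≤ i ≤ t (0-based index i with 1 ≤ i < t): 𝒜(η_i, K_i) has dimension n-1,
    -- i.e. its simplices have at most n vertices and some has exactly n.
    attach  : ∀ (i : Fin (length order)) → 1 ≤ F.toℕ i →
      (∃[ τ ] (InAttachment n (take (suc (F.toℕ i)) order) (lookup order i) τ × ∣ τ ∣ ≡ n)) ×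
      (∀ τ → InAttachment n (take (suc (F.toℕ i)) order) (lookup order i) τ → ∣ τ ∣ ≤ n)

-- Call two facets (n-simplices) adjacent when they share a ridge ((n-1)-simplex).
-- Since distinct facets never share n+1 vertices, the attachment of a facet has dimension
-- n-1 exactly when it shares a ridge with an earlier facet; so an (n-1)-ordering is a
-- listing of all facets in which each facet after the first is adjacent to an earlier one.
-- Given such a listing and a ridge τ, the facets having a ridge joined to τ by a path
-- sequence are closed under adjacency, hence are all facets (a path lengthened by one
-- step is cut back to its last occurrence of the new simplices to stay a path).
-- Conversely, a greedy search that keeps adding a new facet adjacent to one already
-- listed stops at a set closed under adjacency; walking along path sequences, which
-- exist by connectivity, shows that this set contains every facet, and the order of
-- discovery is an (n-1)-ordering.

module Submission where

open import Defs

import Data.Bool as Bool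
open import Data.Fin as F using (Fin; toℕ; inject₁; fromℕ)
import Data.Fin.Induction as Fin
open import Data.Fin.Properties using (toℕ-inject₁; toℕ-injective)
open import Data.Fin.Subset using (Subset; _⊆_; ∣_∣; Nonempty; inside; outside)
open import Data.Fin.Subset.Properties
  using (drop-∷-⊆; p⊆q⇒∣p∣≤∣q∣; nonempty?; Empty-unique; ∣⊥∣≡0; _⊆?_; ⊆-refl)
open import Data.List using (List; []; _∷_; [_]; _++_; filter; length; take; lookup)
open import Data.List.Properties using (++-assoc; ++-identityʳ)
open import Data.List.Membership.Propositional using (_∈_; _∉_; find; lose)
open import Data.List.Membership.Propositional.Properties
  using (∈-++⁺ˡ; ∈-++⁺ʳ; ∈-lookup; ∈-filter⁺; ∈-filter⁻)
import Data.List.Relation.Unary.All as ListAll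
import Data.List.Relation.Unary.AllPairs as AllPairs
open import Data.List.Relation.Unary.Any as Any using (Any; here; there; any?)
open import Data.List.Relation.Unary.Any.Properties using (lookup-index)
open import Data.List.Relation.Unary.Unique.Propositional using (Unique)
open import Data.List.Relation.Unary.Unique.Propositional.Properties using (++⁺)
open import Data.Nat using (ℕ; suc; _≤_; _<_; z≤n; s≤s; _≟_)
open import Data.Nat.Induction using (Acc; acc; <-wellFounded)
open import Data.Nat.Properties
  using (suc-injective; <⇒≢; m≤n⇒m≤1+n; m<n⇒m<1+n; 1+n≢n; ≤-pred; ≤∧≢⇒<)
open import Data.Product using (Σ; ∃-syntax; _×_; _,_; proj₁; proj₂)
open import Data.Unit using (⊤; tt)
open import Data.Vec as Vec using (Vec; []; _∷_; here; there)
open import Data.Vec.Membership.Propositional using () renaming (_∈_ to _∈ᵥ_; _∉_ to _∉ᵥ_)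
open import Data.Vec.Membership.Propositional.Properties using () renaming (∈-lookup to ∈ᵥ-lookup)
open import Data.Vec.Properties using (≡-dec)
open import Data.Vec.Relation.Unary.Any using (here; there)
open import Function using (Injective; _∘_)
open import Function.Bundles using (_⇔_; Equivalence; mk⇔)
open import Function.Construct.Composition using (_⇔-∘_)
open import Function.Construct.Identity using (⇔-id)
open import Function.Construct.Symmetry using (⇔-sym)
open import Induction.WellFounded using (module All)
open import Level using (0ℓ)
open import Relation.Binary.Definitions using (DecidableEquality)
open import Relation.Binary.PropositionalEquality using (_≡_; _≢_; refl; sym; trans; cong; subst)
open import Relation.Nullary using (¬_; Dec; yes; no; contradiction)
open import Relation.Nullary.Decidable using (_×-dec_; ¬?; map′)
open import Relation.Unary using (Pred; Decidable)

_≟ˢ_ : ∀ {m} → DecidableEquality (Subset m)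
_≟ˢ_ = ≡-dec Bool._≟_

p⊆q∧∣p∣≡∣q∣⇒p≡q : ∀ {m} {p q : Subset m} → p ⊆ q → ∣ p ∣ ≡ ∣ q ∣ → p ≡ q
p⊆q∧∣p∣≡∣q∣⇒p≡q {p = []} {[]} _ _ = refl
p⊆q∧∣p∣≡∣q∣⇒p≡q {p = outside ∷ p} {outside ∷ q} p⊆q e =
  cong (outside ∷_) (p⊆q∧∣p∣≡∣q∣⇒p≡q (drop-∷-⊆ p⊆q) e)
p⊆q∧∣p∣≡∣q∣⇒p≡q {p = outside ∷ p} {inside ∷ q} p⊆q e =
  contradiction e (<⇒≢ (s≤s (p⊆q⇒∣p∣≤∣q∣ (drop-∷-⊆ p⊆q))))
p⊆q∧∣p∣≡∣q∣⇒p≡q {p = inside ∷ p} {outside ∷ q} p⊆q e with () ← p⊆q here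
p⊆q∧∣p∣≡∣q∣⇒p≡q {p = inside ∷ p} {inside ∷ q} p⊆q e =
  cong (inside ∷_) (p⊆q∧∣p∣≡∣q∣⇒p≡q (drop-∷-⊆ p⊆q) (suc-injective e))

1≤∣p∣⇒Nonempty : ∀ {m} (p : Subset m) → 1 ≤ ∣ p ∣ → Nonempty p
1≤∣p∣⇒Nonempty {m} p 1≤∣p∣ with nonempty? p
... | yes ne = ne
... | no empty = contradiction (trans (cong ∣_∣ (Empty-unique empty)) (∣⊥∣≡0 m)) (<⇒≢ 1≤∣p∣ ∘ sym)

∃-subset-of-size-pred : ∀ {m k} (p : Subset m) → ∣ p ∣ ≡ suc k → ∃[ q ] (q ⊆ p × ∣ q ∣ ≡ k)
∃-subset-of-size-pred (inside ∷ p) e =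
  outside ∷ p , (λ { (there x∈p) → there x∈p }) , suc-injective e
∃-subset-of-size-pred (outside ∷ p) e with q , q⊆p , ∣q∣ ← ∃-subset-of-size-pred p e =
  outside ∷ q , (λ { (there x∈q) → there (q⊆p x∈q) }) , ∣q∣

∷-lookup-injective : ∀ {A : Set} {k} {x : A} {xs : Vec A k} →
  x ∉ᵥ xs → Injective _≡_ _≡_ (Vec.lookup xs) → Injective _≡_ _≡_ (Vec.lookup (x ∷ xs))
∷-lookup-injective x∉ inj {F.zero} {F.zero} _ = refl
∷-lookup-injective {xs = xs} x∉ inj {F.zero} {F.suc j} e =
  contradiction (subst (_∈ᵥ xs) (sym e) (∈ᵥ-lookup j xs)) x∉
∷-lookup-injective {xs = xs} x∉ inj {F.suc i} {F.zero} e =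
  contradiction (subst (_∈ᵥ xs) e (∈ᵥ-lookup i xs)) x∉
∷-lookup-injective x∉ inj {F.suc i} {F.suc j} e = cong F.suc (inj e)

module _ {A : Set} {P Q : Pred A 0ℓ} (P? : Decidable P) (Q? : Decidable Q)
         (P⊆Q : ∀ {x} → P x → Q x) where

  length-filter-mono : ∀ xs → length (filter P? xs) ≤ length (filter Q? xs)
  length-filter-mono [] = z≤n
  length-filter-mono (x ∷ xs) with P? x | Q? x
  ... | yes _ | yes _  = s≤s (length-filter-mono xs)
  ... | yes p | no ¬q  = contradiction (P⊆Q p) ¬q
  ... | no _  | yes _  = m≤n⇒m≤1+n (length-filter-mono xs)
  ... | no _  | no _   = length-filter-mono xs

  length-filter-< : ∀ {xs} → Any (λ x → Q x × ¬ P x) xs →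
    length (filter P? xs) < length (filter Q? xs)
  length-filter-< {x ∷ xs} (here (q , ¬p)) with P? x | Q? x
  ... | yes p | _      = contradiction p ¬p
  ... | no _  | yes _  = s≤s (length-filter-mono xs)
  ... | no _  | no ¬q  = contradiction q ¬q
  length-filter-< {x ∷ xs} (there w) with P? x | Q? x
  ... | yes _ | yes _  = s≤s (length-filter-< w)
  ... | yes p | no ¬q  = contradiction (P⊆Q p) ¬q
  ... | no _  | yes _  = m<n⇒m<1+n (length-filter-< w)
  ... | no _  | no _   = length-filter-< w

module _ {A : Set} where

  ∈-take⁻ : ∀ {y : A} k xs → y ∈ take k xs → y ∈ xs
  ∈-take⁻ (suc k) (x ∷ xs) (here y≡x) = here y≡x
  ∈-take⁻ (suc k) (x ∷ xs) (there y∈) = there (∈-take⁻ k xs y∈)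

  ∈-take⇒lookup : ∀ {y : A} k xs → y ∈ take k xs → ∃[ j ] (toℕ j < k × lookup xs j ≡ y)
  ∈-take⇒lookup (suc k) (x ∷ xs) (here y≡x) = F.zero , s≤s z≤n , sym y≡x
  ∈-take⇒lookup (suc k) (x ∷ xs) (there y∈) with j , j<k , xs[j]≡y ← ∈-take⇒lookup k xs y∈ =
    F.suc j , s≤s j<k , xs[j]≡y

linked⇒all-equivalent : ∀ {N} (Q : Pred (Fin N) 0ℓ) →
  (∀ i → 1 ≤ toℕ i → ∃[ j ] (j F.< i × (Q j ⇔ Q i))) → ∀ i j → Q i → Q j
linked⇒all-equivalent {suc N} Q link i j Qi = Equivalence.from (⇔Q₀ j) (Equivalence.to (⇔Q₀ i) Qi)
  where
    ⇔Q₀ : ∀ i → Q i ⇔ Q F.zero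
    ⇔Q₀ = All.wfRec Fin.<-wellFounded 0ℓ (λ i → Q i ⇔ Q F.zero) step
      where
        step : ∀ i → (∀ {j} → j F.< i → Q j ⇔ Q F.zero) → Q i ⇔ Q F.zero
        step F.zero _ = ⇔-id _
        step (F.suc i) rec with j , j<i , Qj⇔Qi ← link (F.suc i) (s≤s z≤n) = rec j<i ⇔-∘ ⇔-sym Qj⇔Qi

module Exploration {A : Set} (_≟_ : DecidableEquality A) (U : List A)
                   (R : A → A → Set) (R? : ∀ x y → Dec (R x y)) where

  open import Data.List.Membership.DecPropositional _≟_ using (_∈?_)

  unexplored : List A → ℕ
  unexplored seen = length (filter (λ y → ¬? (y ∈? seen)) U)

  Growth : List A → List A → Set
  Growth seen [] = ⊤
  Growth seen (x ∷ xs) = x ∈ U × x ∉ seen × (∃[ h ] (h ∈ seen × R h x)) × Growth (seen ++ [ x ]) xs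

  Closed : Pred A 0ℓ → Set
  Closed P = ∀ {h g} → g ∈ U → P h → R h g → P g

  unexplored-shrinks : ∀ {seen g} → g ∈ U → g ∉ seen → unexplored (seen ++ [ g ]) < unexplored seen
  unexplored-shrinks {seen} {g} g∈U g∉ =
    length-filter-< (λ y → ¬? (y ∈? (seen ++ [ g ]))) (λ y → ¬? (y ∈? seen))
      (λ y∉ y∈ → y∉ (∈-++⁺ˡ y∈)) (lose g∈U (g∉ , λ g∉′ → g∉′ (∈-++⁺ʳ seen (here refl))))

  explore′ : ∀ seen → Acc _<_ (unexplored seen) → ∃[ xs ] (Growth seen xs × Closed (_∈ seen ++ xs))
  explore′ seen (acc rs) with any? (λ g → ¬? (g ∈? seen) ×-dec any? (λ h → R? h g) seen) U
  ... | no stuck = [] , tt , subst (λ ys → Closed (_∈ ys)) (sym (++-identityʳ seen)) closed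
    where
      closed : Closed (_∈ seen)
      closed {h} {g} g∈U h∈ Rhg with g ∈? seen
      ... | yes g∈ = g∈
      ... | no g∉ = contradiction (lose g∈U (g∉ , lose h∈ Rhg)) stuck
  ... | yes found
    with g , g∈U , g∉ , reach ← find found
    with h , h∈ , Rhg ← find reach
    with xs , growth , closed ← explore′ (seen ++ [ g ]) (rs (unexplored-shrinks g∈U g∉))
    = g ∷ xs , (g∈U , g∉ , (h , h∈ , Rhg) , growth)
    , subst (λ ys → Closed (_∈ ys)) (++-assoc seen [ g ] xs) closed

  explore : ∀ seen → ∃[ xs ] (Growth seen xs × Closed (_∈ seen ++ xs))
  explore seen = explore′ seen (<-wellFounded _)

  Growth-⊆ : ∀ {seen xs} → Growth seen xs → ∀ {y} → y ∈ xs → y ∈ U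
  Growth-⊆ {xs = x ∷ xs} (x∈U , _) (here refl) = x∈U
  Growth-⊆ {xs = x ∷ xs} (_ , _ , _ , growth) (there y∈) = Growth-⊆ growth y∈

  Growth-unique : ∀ {seen xs} → Unique seen → Growth seen xs → Unique (seen ++ xs)
  Growth-unique {seen} {[]} u _ = subst Unique (sym (++-identityʳ seen)) u
  Growth-unique {seen} {x ∷ xs} u (_ , x∉ , _ , growth) =
    subst Unique (++-assoc seen [ x ] xs)
      (Growth-unique (++⁺ u (ListAll.[] AllPairs.∷ AllPairs.[]) fresh) growth)
    where
      fresh : ∀ {v} → ¬ (v ∈ seen × v ∈ [ x ])
      fresh (v∈ , here refl) = x∉ v∈

  Growth-attached : ∀ {seen xs} → Growth seen xs → ∀ (k : Fin (length xs)) →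
    ∃[ h ] (h ∈ seen ++ take (suc (toℕ k)) xs × h ≢ lookup xs k × R h (lookup xs k))
  Growth-attached {seen} {x ∷ xs} (_ , x∉ , (h , h∈ , Rhx) , _) F.zero =
    h , ∈-++⁺ˡ h∈ , (λ { refl → x∉ h∈ }) , Rhx
  Growth-attached {seen} {x ∷ xs} (_ , _ , _ , growth) (F.suc k)
    with h , h∈ , h≢ , Rh ← Growth-attached growth k
    = h , subst (h ∈_) (++-assoc seen [ x ] (take (suc (toℕ k)) xs)) h∈ , h≢ , Rh

module Complex {m : ℕ} (n : ℕ) (K : List (Subset m)) where

  open import Data.Vec.Membership.DecPropositional (_≟ˢ_ {m}) using () renaming (_∈?_ to _∈ᵥ?_)

  Ridge : Subset m → Set
  Ridge σ = σ ∈ K × ∣ σ ∣ ≡ n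

  Facet : Subset m → Set
  Facet η = η ∈ K × ∣ η ∣ ≡ suc n

  Adjacent : Subset m → Subset m → Set
  Adjacent η η′ = ∃[ ρ ] (Ridge ρ × ρ ⊆ η × ρ ⊆ η′)

  adjacent-sym : ∀ {η η′} → Adjacent η η′ → Adjacent η′ η
  adjacent-sym (ρ , ρ-ridge , ρ⊆η , ρ⊆η′) = ρ , ρ-ridge , ρ⊆η′ , ρ⊆η

  adjacent? : ∀ η η′ → Dec (Adjacent η η′)
  adjacent? η η′ = map′ from-any to-any (any? (λ ρ → (∣ ρ ∣ ≟ n) ×-dec (ρ ⊆? η) ×-dec (ρ ⊆? η′)) K)
    where
      Shared : Subset m → Set
      Shared ρ = ∣ ρ ∣ ≡ n × ρ ⊆ η × ρ ⊆ η′
      from-any : Any Shared K → Adjacent η η′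
      from-any found with ρ , ρ∈K , ∣ρ∣ , ρ⊆η , ρ⊆η′ ← find found = ρ , (ρ∈K , ∣ρ∣) , ρ⊆η , ρ⊆η′
      to-any : Adjacent η η′ → Any Shared K
      to-any (ρ , (ρ∈K , ∣ρ∣) , ρ⊆η , ρ⊆η′) = lose ρ∈K (∣ρ∣ , ρ⊆η , ρ⊆η′)

  ridge≢facet : ∀ {σ η} → Ridge σ → Facet η → σ ≢ η
  ridge≢facet (_ , ∣σ∣) (_ , ∣η∣) refl = 1+n≢n (trans (sym ∣η∣) ∣σ∣)

  -- PathSeq n K σ τ built by prepending steps σ ⊆ η ⊇ ρ; freshness of σ and η keeps all
  -- simplices distinct (σ ≢ ρ since ρ occurs in sigs P; ridges and facets differ in size).
  data Path : Subset m → Subset m → Set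
  steps : ∀ {σ τ} → Path σ τ → ℕ
  sigs : ∀ {σ τ} (P : Path σ τ) → Vec (Subset m) (suc (steps P))
  etas : ∀ {σ τ} (P : Path σ τ) → Vec (Subset m) (steps P)

  data Path where
    stay : ∀ {τ} → Ridge τ → Path τ τ
    step : ∀ {σ η ρ τ} → Ridge σ → Facet η → σ ⊆ η → ρ ⊆ η →
      (P : Path ρ τ) → σ ∉ᵥ sigs P → η ∉ᵥ etas P → Path σ τ

  steps (stay _) = 0
  steps (step _ _ _ _ P _ _) = suc (steps P)

  sigs {σ} (stay _) = σ ∷ []
  sigs {σ} (step _ _ _ _ P _ _) = σ ∷ sigs P

  etas (stay _) = []
  etas (step {η = η} _ _ _ _ P _ _) = η ∷ etas P

  suffix-from : ∀ {σ ρ τ} (P : Path σ τ) → ρ ∈ᵥ sigs P → Path ρ τ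
  suffix-from (stay σ-ridge) (here refl) = stay σ-ridge
  suffix-from P@(step _ _ _ _ _ _ _) (here refl) = P
  suffix-from (step _ _ _ _ P _ _) (there ρ∈) = suffix-from P ρ∈

  suffix-after : ∀ {σ η τ} (P : Path σ τ) → η ∈ᵥ etas P →
    ∃[ ρ ] (ρ ⊆ η × Σ (Path ρ τ) λ Q → η ∉ᵥ etas Q × (∀ {x} → x ∈ᵥ sigs Q → x ∈ᵥ sigs P))
  suffix-after (step _ _ _ ρ⊆η P _ η∉) (here refl) = _ , ρ⊆η , P , η∉ , there
  suffix-after (step _ _ _ _ P _ _) (there η∈) with ρ , ρ⊆η , Q , η∉ , Q⊆P ← suffix-after P η∈ =
    ρ , ρ⊆η , Q , η∉ , there ∘ Q⊆P

  -- Prepend the step σ ⊆ η ⊇ ρ to P, first cutting P back so that σ and η do not reoccur.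
  extend : ∀ {ρ η σ τ} → Path ρ τ → Facet η → ρ ⊆ η → Ridge σ → σ ⊆ η → Path σ τ
  extend {η = η} {σ} P η-facet ρ⊆η σ-ridge σ⊆η with σ ∈ᵥ? sigs P
  ... | yes σ∈ = suffix-from P σ∈
  ... | no σ∉ with η ∈ᵥ? etas P
  ...   | no η∉ = step σ-ridge η-facet σ⊆η ρ⊆η P σ∉ η∉
  ...   | yes η∈ with ρ′ , ρ′⊆η , Q , η∉ , Q⊆P ← suffix-after P η∈ =
    step σ-ridge η-facet σ⊆η ρ′⊆η Q (σ∉ ∘ Q⊆P) η∉

  sigs-ridge : ∀ {σ τ} (P : Path σ τ) k → Ridge (Vec.lookup (sigs P) k)
  sigs-ridge (stay σ-ridge) F.zero = σ-ridge
  sigs-ridge (step σ-ridge _ _ _ _ _ _) F.zero = σ-ridge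
  sigs-ridge (step _ _ _ _ P _ _) (F.suc k) = sigs-ridge P k

  etas-facet : ∀ {σ τ} (P : Path σ τ) k → Facet (Vec.lookup (etas P) k)
  etas-facet (step _ η-facet _ _ _ _ _) F.zero = η-facet
  etas-facet (step _ _ _ _ P _ _) (F.suc k) = etas-facet P k

  head-sigs : ∀ {σ τ} (P : Path σ τ) → Vec.lookup (sigs P) F.zero ≡ σ
  head-sigs (stay _) = refl
  head-sigs (step _ _ _ _ _ _ _) = refl

  last-sigs : ∀ {σ τ} (P : Path σ τ) → Vec.lookup (sigs P) (fromℕ (steps P)) ≡ τ
  last-sigs (stay _) = refl
  last-sigs (step _ _ _ _ P _ _) = last-sigs P

  sigs⊆etasˡ : ∀ {σ τ} (P : Path σ τ) k → Vec.lookup (sigs P) (inject₁ k) ⊆ Vec.lookup (etas P) k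
  sigs⊆etasˡ (step _ _ σ⊆η _ _ _ _) F.zero = σ⊆η
  sigs⊆etasˡ (step _ _ _ _ P _ _) (F.suc k) = sigs⊆etasˡ P k

  sigs⊆etasʳ : ∀ {σ τ} (P : Path σ τ) k → Vec.lookup (sigs P) (F.suc k) ⊆ Vec.lookup (etas P) k
  sigs⊆etasʳ (step {η = η} _ _ _ ρ⊆η P _ _) F.zero = subst (_⊆ η) (sym (head-sigs P)) ρ⊆η
  sigs⊆etasʳ (step _ _ _ _ P _ _) (F.suc k) = sigs⊆etasʳ P k

  sigs-injective : ∀ {σ τ} (P : Path σ τ) → Injective _≡_ _≡_ (Vec.lookup (sigs P))
  sigs-injective (stay _) {F.zero} {F.zero} _ = refl
  sigs-injective (step _ _ _ _ P σ∉ _) = ∷-lookup-injective σ∉ (sigs-injective P)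

  etas-injective : ∀ {σ τ} (P : Path σ τ) → Injective _≡_ _≡_ (Vec.lookup (etas P))
  etas-injective (step _ _ _ _ P _ η∉) = ∷-lookup-injective η∉ (etas-injective P)

  toPathSeq : ∀ {σ τ} → Path σ τ → PathSeq n K σ τ
  toPathSeq P = record
    { r = steps P
    ; sigs = sigs P
    ; etas = etas P
    ; sig-in = sigs-ridge P
    ; eta-in = etas-facet P
    ; step-≢ = λ k e → 1+n≢n (trans (cong toℕ (sym (sigs-injective P e))) (toℕ-inject₁ k))
    ; step-l = sigs⊆etasˡ P
    ; step-r = sigs⊆etasʳ P
    ; sigs-distinct = sigs-injective P
    ; etas-distinct = etas-injective P
    ; cross-distinct = λ i j → ridge≢facet (sigs-ridge P i) (etas-facet P j)
    ; start = head-sigs P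
    ; end = last-sigs P
    }

  PathSeq-covered : ∀ {σ τ} (In : Pred (Subset m) 0ℓ) →
    (∀ {h η} → Facet η → In h → Adjacent h η → In η) →
    PathSeq n K σ τ → ∃[ h ] (In h × σ ⊆ h) → ∃[ h ] (In h × τ ⊆ h)
  PathSeq-covered {σ} {τ} In closed P (h , In-h , σ⊆h) =
    subst (λ x → ∃[ h ] (In h × x ⊆ h)) end
      (Fin.<-weakInduction Covered covered₀ covered-suc (fromℕ r))
    where
      open PathSeq P renaming (sigs to σs; etas to ηs)
      Covered : Pred (Fin (suc r)) 0ℓ
      Covered k = ∃[ h ] (In h × Vec.lookup σs k ⊆ h)
      covered₀ : Covered F.zero
      covered₀ = h , In-h , subst (_⊆ h) (sym start) σ⊆h
      covered-suc : ∀ k → Covered (inject₁ k) → Covered (F.suc k)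
      covered-suc k (h , In-h , σₖ⊆h) =
        Vec.lookup ηs k
        , closed (eta-in k) In-h (Vec.lookup σs (inject₁ k) , sig-in (inject₁ k) , σₖ⊆h , step-l k)
        , step-r k

  attachment-size≤ : ∀ {S : List (Subset m)} {η τ} →
    ∣ η ∣ ≡ suc n → InAttachment n S η τ → ∣ τ ∣ ≤ n
  attachment-size≤ {η = η} {τ} ∣η∣ (_ , τ⊆η , η′ , _ , ∣η′∣ , η′≢η , τ⊆η′) =
    ≤-pred (≤∧≢⇒< (subst (∣ τ ∣ ≤_) ∣η∣ (p⊆q⇒∣p∣≤∣q∣ τ⊆η)) τ≢η)
    where
      τ≢η : ∣ τ ∣ ≢ suc n
      τ≢η ∣τ∣ with refl ← p⊆q∧∣p∣≡∣q∣⇒p≡q τ⊆η (trans ∣τ∣ (sym ∣η∣)) =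
        η′≢η (sym (p⊆q∧∣p∣≡∣q∣⇒p≡q τ⊆η′ (trans ∣τ∣ (sym ∣η′∣))))

module PureComplex {m : ℕ} (n : ℕ) (1≤n : 1 ≤ n) (K : List (Subset m)) (pure-K : IsPure n K) where

  open Complex n K
  open IsPure pure-K
  open IsSimplicialComplex complex

  ridge-nonempty : ∀ {σ : Subset m} → ∣ σ ∣ ≡ n → Nonempty σ
  ridge-nonempty {σ} ∣σ∣ = 1≤∣p∣⇒Nonempty σ (subst (1 ≤_) (sym ∣σ∣) 1≤n)

  facet-nonempty : ∀ {η : Subset m} → ∣ η ∣ ≡ suc n → Nonempty η
  facet-nonempty {η} ∣η∣ = 1≤∣p∣⇒Nonempty η (subst (1 ≤_) (sym ∣η∣) (s≤s z≤n))

  face-ridge : ∀ {σ η} → η ∈ K → σ ⊆ η → ∣ σ ∣ ≡ n → Ridge σ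
  face-ridge {σ} {η} η∈K σ⊆η ∣σ∣ = closed η σ η∈K σ⊆η (ridge-nonempty ∣σ∣) , ∣σ∣

  module FromOrdering (O : Ordering n K) where

    open Ordering O

    ordered-facet : ∀ {η} → η ∈ order → Facet η
    ordered-facet = Equivalence.to (lists-n _)

    facet-index : ∀ {η} → Facet η → ∃[ i ] (lookup order i ≡ η)
    facet-index η-facet =
      let η∈ = Equivalence.from (lists-n _) η-facet in Any.index η∈ , sym (lookup-index η∈)

    attached-to-earlier : ∀ i → 1 ≤ toℕ i →
      ∃[ j ] (j F.< i × Adjacent (lookup order j) (lookup order i))
    attached-to-earlier i 1≤i
      with τ , (_ , τ⊆ηᵢ , η′ , (_ , η″ , η″∈ , η′⊆η″) , ∣η′∣ , η′≢ηᵢ , τ⊆η′) , ∣τ∣ ← proj₁ (attach i 1≤i)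
      with j , j≤i , ηⱼ≡η″ ← ∈-take⇒lookup (suc (toℕ i)) order η″∈
      = j , j<i , τ , face-ridge (proj₁ (ordered-facet (∈-lookup i))) τ⊆ηᵢ ∣τ∣
      , subst (τ ⊆_) η′≡ηⱼ τ⊆η′ , τ⊆ηᵢ
      where
        ∣η″∣ : ∣ η″ ∣ ≡ suc n
        ∣η″∣ = proj₂ (ordered-facet (∈-take⁻ _ order η″∈))
        η′≡ηⱼ : η′ ≡ lookup order j
        η′≡ηⱼ = trans (p⊆q∧∣p∣≡∣q∣⇒p≡q η′⊆η″ (trans ∣η′∣ (sym ∣η″∣))) (sym ηⱼ≡η″)
        j<i : j F.< i
        j<i = ≤∧≢⇒< (≤-pred j≤i)
          (λ j≡i → η′≢ηᵢ (trans η′≡ηⱼ (cong (lookup order) (toℕ-injective j≡i))))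

    Reaches : Subset m → Subset m → Set
    Reaches τ η = ∃[ ρ ] (ρ ⊆ η × Path ρ τ)

    reaches-adjacent : ∀ {τ η η′} → Facet η → Adjacent η η′ → Reaches τ η → Reaches τ η′
    reaches-adjacent η-facet (ρ , ρ-ridge , ρ⊆η , ρ⊆η′) (ρ₀ , ρ₀⊆η , P) =
      ρ , ρ⊆η′ , extend P η-facet ρ₀⊆η ρ-ridge ρ⊆η

    reaches-facet : ∀ {τ η η′} → Facet η → Facet η′ → Reaches τ η → Reaches τ η′
    reaches-facet {τ} η-facet η′-facet reaches
      with i , ηᵢ≡η ← facet-index η-facet
      with j , ηⱼ≡η′ ← facet-index η′-facet
      = subst (Reaches τ) ηⱼ≡η′
          (linked⇒all-equivalent (Reaches τ ∘ lookup order) link i j (subst (Reaches τ) (sym ηᵢ≡η) reaches))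
      where
        link : ∀ i → 1 ≤ toℕ i →
          ∃[ j ] (j F.< i × (Reaches τ (lookup order j) ⇔ Reaches τ (lookup order i)))
        link i 1≤i with j , j<i , adj ← attached-to-earlier i 1≤i =
          j , j<i , mk⇔ (reaches-adjacent (ordered-facet (∈-lookup j)) adj)
                        (reaches-adjacent (ordered-facet (∈-lookup i)) (adjacent-sym adj))

    ordering⇒connected : Connected n K
    ordering⇒connected σ τ σ∈K ∣σ∣ τ∈K ∣τ∣ _
      with ησ , ησ∈K , ∣ησ∣ , σ⊆ησ ← pure σ σ∈K
      with ητ , ητ∈K , ∣ητ∣ , τ⊆ητ ← pure τ τ∈K
      with ρ , ρ⊆ησ , P ← reaches-facet (ητ∈K , ∣ητ∣) (ησ∈K , ∣ησ∣) (τ , τ⊆ητ , stay (τ∈K , ∣τ∣))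
      = toPathSeq (extend P (ησ∈K , ∣ησ∣) ρ⊆ησ (σ∈K , ∣σ∣) σ⊆ησ)

  module FromConnected (connected : Connected n K) where

    facet-list : List (Subset m)
    facet-list = filter (λ η → ∣ η ∣ ≟ suc n) K

    open Exploration _≟ˢ_ facet-list Adjacent adjacent?

    η₀ : Subset m
    η₀ = proj₁ (proj₁ dim)

    η₀-facet : Facet η₀
    η₀-facet = proj₂ (proj₁ dim)

    explored : ∃[ xs ] (Growth [ η₀ ] xs × Closed (_∈ η₀ ∷ xs))
    explored = explore [ η₀ ]

    order : List (Subset m)
    order = η₀ ∷ proj₁ explored

    growth : Growth [ η₀ ] (proj₁ explored)
    growth = proj₁ (proj₂ explored)

    ordered-facet : ∀ {η} → η ∈ order → Facet η
    ordered-facet (here refl) = η₀-facet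
    ordered-facet (there η∈) = ∈-filter⁻ _ (Growth-⊆ growth η∈)

    order-closed : ∀ {h η} → Facet η → h ∈ order → Adjacent h η → η ∈ order
    order-closed (η∈K , ∣η∣) = proj₂ (proj₂ explored) (∈-filter⁺ _ η∈K ∣η∣)

    ridge-covered : ∀ {ρ} → Ridge ρ → ∃[ h ] (h ∈ order × ρ ⊆ h)
    ridge-covered {ρ} (ρ∈K , ∣ρ∣)
      with ρ₀ , ρ₀⊆η₀ , ∣ρ₀∣ ← ∃-subset-of-size-pred η₀ (proj₂ η₀-facet)
      with ρ₀ ≟ˢ ρ
    ... | yes refl = η₀ , here refl , ρ₀⊆η₀
    ... | no ρ₀≢ρ = PathSeq-covered (_∈ order) order-closed
      (connected ρ₀ ρ (proj₁ (face-ridge (proj₁ η₀-facet) ρ₀⊆η₀ ∣ρ₀∣)) ∣ρ₀∣ ρ∈K ∣ρ∣ ρ₀≢ρ)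
      (η₀ , here refl , ρ₀⊆η₀)

    facet-ordered : ∀ {η} → Facet η → η ∈ order
    facet-ordered {η} η-facet@(η∈K , ∣η∣)
      with ρ , ρ⊆η , ∣ρ∣ ← ∃-subset-of-size-pred η ∣η∣
      with ρ-ridge ← face-ridge η∈K ρ⊆η ∣ρ∣
      with h , h∈ , ρ⊆h ← ridge-covered ρ-ridge
      = order-closed η-facet h∈ (ρ , ρ-ridge , ρ⊆h , ρ⊆η)

    connected⇒ordering : Ordering n K
    connected⇒ordering = record
      { order = order
      ; unique = Growth-unique (ListAll.[] AllPairs.∷ AllPairs.[]) growth
      ; lists-n = λ η → mk⇔ ordered-facet facet-ordered
      ; attach = attach
      }
      where
        attach : ∀ i → 1 ≤ toℕ i →
          (∃[ τ ] (InAttachment n (take (suc (toℕ i)) order) (lookup order i) τ × ∣ τ ∣ ≡ n)) ×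
          (∀ τ → InAttachment n (take (suc (toℕ i)) order) (lookup order i) τ → ∣ τ ∣ ≤ n)
        attach (F.suc k) _
          with h , h∈ , h≢ηₖ , τ , (_ , ∣τ∣) , τ⊆h , τ⊆ηₖ ← Growth-attached growth k
          with ∣h∣ ← proj₂ (ordered-facet (∈-take⁻ (suc (suc (toℕ k))) order h∈))
          = ( τ
            , (ridge-nonempty ∣τ∣ , τ⊆ηₖ , h , (facet-nonempty ∣h∣ , h , h∈ , ⊆-refl) , ∣h∣ , h≢ηₖ , τ⊆h)
            , ∣τ∣ )
          , λ _ → attachment-size≤ (proj₂ (ordered-facet (∈-lookup (F.suc k))))


theorem3p1 : ∀ {m : ℕ} (n : ℕ) → 1 ≤ n → (K : List (Subset m)) → IsPure n K →
    (Connected n K ⇔ Ordering n K)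
theorem3p1 n 1≤n K pure-K = mk⇔ FromConnected.connected⇒ordering FromOrdering.ordering⇒connected
  where open PureComplex n 1≤n K pure-K
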